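{- Let $\mathbb X$ be a chainable relational structure with domain $X$, let $\mathbb L=\langle X,<\rangle\in\mathcal L_{\mathbb X}$ and $f\in\mathrm{Emb}(\mathbb X)$. Let $f^{ -1}[<]=\{\langle x,x'\rangle\in X^2: f(x)<f(x')\}$ and $\mathbb L_f:=\langle X,f^{ -1}[<]\rangle$. Then $\mathbb L_f\in\mathcal L_{\mathbb X}$ and $f$ is an embedding of $\mathbb L_f$ into $\mathbb L$.
   Context: $\mathrm{Emb}(\mathbb X)$ is the set of self-embeddings of $\mathbb X$; $\mathrm{Pa}(\mathbb X)$ the set of partial automorphisms (isomorphisms between substructures). $\mathbb X$ is chainable iff there is a linear order $\lhd$ on $X$ with $\mathrm{Pa}(\langle X,\lhd\rangle)\subset\mathrm{Pa}(\mathbb X)$; $\mathcal L_{\mathbb X}$ is the set of all linear orders $\langle X,\lhd\rangle$ with this property (for infinite $\mathbb X$ this is equivalent to each relation of $\mathbb X$ being definable in $\langle X,\lhd\rangle$ by a quantifier-free parameter-free first-order formula). -}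

module Defs where

open import Level using (0ℓ)
open import Data.Nat using (ℕ)
open import Data.Fin using (Fin; zero; suc)
open import Data.Unit using (⊤; tt)
open import Data.Product using (Σ; _×_)
open import Function.Bundles using (_⇔_)
open import Relation.Binary.Core using (Rel)
open import Relation.Binary.Structures using (IsStrictTotalOrder)
open import Relation.Binary.PropositionalEquality using (_≡_)

record RelStr (X : Set) : Set₁ where
  field
    Sym   : Set
    arity : Sym → ℕ
    rel   : (i : Sym) → (Fin (arity i) → X) → Set
open RelStr public

record PartialMap (X : Set) : Set₁ where
  field
    dom : X → Set
    app : (x : X) → dom x → X
open PartialMap public

-- p is a partial automorphism of 𝕏: p is an isomorphism between the
-- substructure induced on dom p and the substructure induced on its image
-- (injective, and preserving and reflecting every relation on tuples from dom p).
IsPartialAut : {X : Set} → RelStr X → PartialMap X → Set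
IsPartialAut {X} 𝕏 p =
  ((x y : X) (dx : dom p x) (dy : dom p y) → app p x dx ≡ app p y dy → x ≡ y)
  × ((i : Sym 𝕏) (t : Fin (arity 𝕏 i) → X) (d : (k : Fin (arity 𝕏 i)) → dom p (t k)) →
       rel 𝕏 i t ⇔ rel 𝕏 i (λ k → app p (t k) (d k)))

_⊆Pa_ : {X : Set} → RelStr X → RelStr X → Set₁
𝕐 ⊆Pa 𝕏 = (p : PartialMap _) → IsPartialAut 𝕐 p → IsPartialAut 𝕏 p

BinStr : {X : Set} → Rel X 0ℓ → RelStr X
BinStr _◁_ = record { Sym = ⊤ ; arity = λ _ → 2 ; rel = λ _ t → t zero ◁ t (suc zero) }

InL : {X : Set} → RelStr X → Rel X 0ℓ → Set₁
InL 𝕏 _◁_ = IsStrictTotalOrder _≡_ _◁_ × (BinStr _◁_ ⊆Pa 𝕏)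

Chainable : {X : Set} → RelStr X → Set₁
Chainable {X} 𝕏 = Σ (Rel X 0ℓ) (InL 𝕏)

IsSelfEmbedding : {X : Set} → RelStr X → (X → X) → Set
IsSelfEmbedding {X} 𝕏 f =
  ((x y : X) → f x ≡ f y → x ≡ y)
  × ((i : Sym 𝕏) (t : Fin (arity 𝕏 i) → X) → rel 𝕏 i t ⇔ rel 𝕏 i (λ k → f (t k)))

preimageRel : {X : Set} → (X → X) → Rel X 0ℓ → Rel X 0ℓ
preimageRel f _<_ x x' = f x < f x'

IsOrderEmbedding : {X Y : Set} → Rel X 0ℓ → Rel Y 0ℓ → (X → Y) → Set
IsOrderEmbedding {X} _◁_ _<_ f =
  ((x y : X) → f x ≡ f y → x ≡ y) × ((x x' : X) → (x ◁ x') ⇔ (f x < f x'))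

-- A partial automorphism p of ⟨X, f⁻¹[<]⟩ becomes,
-- conjugated by f, a partial automorphism f p f⁻¹ of ⟨X, <⟩, hence of 𝕏; as f
-- is a self-embedding of 𝕏, p is then a partial automorphism of 𝕏 as well.
module Submission where

open import Defs
open import Data.Fin using (Fin; zero; suc)
open import Data.Product using (Σ; _×_; _,_)
open import Data.Unit using (⊤; tt)
open import Function.Bundles using (_⇔_; mk⇔)
open import Function.Construct.Composition using (_⇔-∘_)
open import Function.Construct.Symmetry using (⇔-sym)
open import Level using (0ℓ)
open import Relation.Binary.Core using (Rel)
open import Relation.Binary.Definitions using (Tri; tri<; tri≈; tri>)
open import Relation.Binary.PropositionalEquality using (_≡_; refl; cong; isEquivalence)
open import Relation.Binary.Structures using (IsStrictTotalOrder)

module _ {X : Set} {f : X → X} (f-injective : (x y : X) → f x ≡ f y → x ≡ y) where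

  preimageRel-isStrictTotalOrder : {_<_ : Rel X 0ℓ} → IsStrictTotalOrder _≡_ _<_ →
                                   IsStrictTotalOrder _≡_ (preimageRel f _<_)
  preimageRel-isStrictTotalOrder {_<_} sto = record
    { isStrictPartialOrder = record
      { isEquivalence = isEquivalence
      ; irrefl        = λ { refl → irrefl refl }
      ; trans         = trans
      ; <-resp-≈      = (λ { refl r → r }) , (λ { refl r → r })
      }
    ; compare = compare′
    }
    where
    open IsStrictTotalOrder sto using (irrefl; trans; compare)
    compare′ : (x y : X) → Tri (f x < f y) (x ≡ y) (f y < f x)
    compare′ x y with compare (f x) (f y)
    ... | tri< a ¬b ¬c = tri< a (λ x≡y → ¬b (cong f x≡y)) ¬c
    ... | tri≈ ¬a b ¬c = tri≈ ¬a (f-injective x y b) ¬c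
    ... | tri> ¬a ¬b c = tri> ¬a (λ x≡y → ¬b (cong f x≡y)) c

  preimageRel-isOrderEmbedding : (_<_ : Rel X 0ℓ) → IsOrderEmbedding (preimageRel f _<_) _<_ f
  preimageRel-isOrderEmbedding _<_ = f-injective , λ _ _ → mk⇔ (λ r → r) (λ r → r)

-- f p f⁻¹, defined on f[dom p]; the witness x of f x ≡ y is part of the domain.
conjugate : {X : Set} → (X → X) → PartialMap X → PartialMap X
conjugate f p = record
  { dom = λ y → Σ _ λ x → dom p x × f x ≡ y
  ; app = λ { _ (x , dx , _) → f (app p x dx) }
  }

module _ {X : Set} {f : X → X} {p : PartialMap X} where

  conjugate-isPartialAut-preimageRel :
    ((x y : X) → f x ≡ f y → x ≡ y) → {_<_ : Rel X 0ℓ} →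
    IsPartialAut (BinStr (preimageRel f _<_)) p → IsPartialAut (BinStr _<_) (conjugate f p)
  conjugate-isPartialAut-preimageRel f-injective {_<_} (p-injective , p-preserves) =
    (λ { _ _ (x , dx , refl) (y , dy , refl) e → cong f (p-injective x y dx dy (f-injective _ _ e)) })
    , preserves
    where
    q : PartialMap X
    q = conjugate f p
    preserves : (i : ⊤) (t : Fin 2 → X) (d : (k : Fin 2) → dom q (t k)) →
                (t zero < t (suc zero)) ⇔ (app q (t zero) (d zero) < app q (t (suc zero)) (d (suc zero)))
    preserves _ t d with t zero | d zero | t (suc zero) | d (suc zero)
    ... | _ | (x₀ , d₀ , refl) | _ | (x₁ , d₁ , refl) =
      p-preserves tt (λ { zero → x₀ ; (suc _) → x₁ }) (λ { zero → d₀ ; (suc zero) → d₁ })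

  isPartialAut-from-conjugate : (𝕏 : RelStr X) → IsSelfEmbedding 𝕏 f →
    IsPartialAut 𝕏 (conjugate f p) → IsPartialAut 𝕏 p
  isPartialAut-from-conjugate 𝕏 (f-injective , f-preserves) (q-injective , q-preserves) =
    (λ x y dx dy e → f-injective x y (q-injective (f x) (f y) (x , dx , refl) (y , dy , refl) (cong f e)))
    , λ i t d →
      ⇔-sym (f-preserves i (λ k → app p (t k) (d k)))
        ⇔-∘ (q-preserves i (λ k → f (t k)) (λ k → t k , d k , refl) ⇔-∘ f-preserves i t)

lemma4p2 : {X : Set} (𝕏 : RelStr X) → Chainable 𝕏 →
    (_<_ : Rel X 0ℓ) → InL 𝕏 _<_ →
    (f : X → X) → IsSelfEmbedding 𝕏 f →
    InL 𝕏 (preimageRel f _<_) × IsOrderEmbedding (preimageRel f _<_) _<_ f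
lemma4p2 𝕏 _ _<_ (<-sto , Pa<⊆Pa𝕏) f f-emb@(f-injective , _) =
  ( ( preimageRel-isStrictTotalOrder f-injective <-sto
    , λ p p∈Pa → isPartialAut-from-conjugate 𝕏 f-emb
                   (Pa<⊆Pa𝕏 (conjugate f p) (conjugate-isPartialAut-preimageRel f-injective {_<_} p∈Pa)) )
  , preimageRel-isOrderEmbedding f-injective _<_ )
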